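{- Let $p$ be a prime and $n\ge1$. Let $G$ be the set of triples $[\vec{x},\vec{y},z]$ with $\vec{x},\vec{y}\in\mathbb{F}_p^n$, $z\in\mathbb{F}_p$, with the operation \[ [\vec{x},\vec{y},z]\cdot[\vec{x}',\vec{y}',z']=[\vec{x}+\vec{x}',\ \vec{y}+\vec{y}',\ z+z'+\langle\vec{x},\vec{y}'\rangle+f(\vec{y},\vec{y}')], \] where $\langle\vec x,\vec y'\rangle=\sum_{i=1}^n x_iy_i'$ and $f(\vec{y},\vec{y}')=\sum_{i=1}^n\left\lfloor\frac{(y_i\bmod p)+(y_i'\bmod p)}{p}\right\rfloor$. Then $G$ is a group, and it is isomorphic to \[ M_n=\langle a_1,b_1,\dots,a_n,b_n,c \mid [a_i,a_j]=[b_i,b_j]=1,\ [a_i,b_j]=1\ (i\ne j),\ [a_i,c]=[b_i,c]=1,\ [a_i,b_i]=c,\ a_i^p=c^p=1,\ b_i^p=c\ (1\le i\le n)\rangle. \]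
   Context: For $y\in\mathbb{F}_p$, $y\bmod p\in\{0,1,\dots,p-1\}$ denotes $y$ regarded as an integer; the integer value of $f$ is then read in $\mathbb{F}_p$ when added to the third coordinate. -}

module Defs where

open import Level using (0ℓ)
open import Data.Nat using (ℕ; zero; suc; _+_; _*_; _/_; NonZero)
open import Data.Nat.DivMod using (_mod_)
open import Data.Nat.Primality using (Prime; prime⇒nonZero)
open import Data.Fin using (Fin; toℕ)
open import Data.Vec using (Vec; zipWith; foldr; replicate)
import Data.Vec as V
open import Data.Bool using (Bool; true; false; not)
open import Data.List using (List; []; _∷_; _++_; reverse; map)
import Data.List as L
open import Data.Product using (_×_; _,_)
open import Relation.Binary.PropositionalEquality using (_≡_)
open import Relation.Nullary using (¬_)
open import Algebra.Bundles.Raw using (RawGroup)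

module HeisenbergLike (p : ℕ) (pr : Prime p) (n : ℕ) where

  private instance
    p≢0 : NonZero p
    p≢0 = prime⇒nonZero pr

  F : Set
  F = Fin p

  _+F_ : F → F → F
  a +F b = (toℕ a + toℕ b) mod p

  _*F_ : F → F → F
  a *F b = (toℕ a * toℕ b) mod p

  0F : F
  0F = 0 mod p

  ⌊_⌋F : ℕ → F
  ⌊ m ⌋F = m mod p

  record Triple : Set where
    constructor [_,_,_]
    field
      x : Vec F n
      y : Vec F n
      z : F

  ⟨_,_⟩ : Vec F n → Vec F n → F
  ⟨ u , v ⟩ = foldr (λ _ → F) _+F_ 0F (zipWith _*F_ u v)

  f : Vec F n → Vec F n → ℕ
  f u v = V.sum (zipWith (λ a b → (toℕ a + toℕ b) / p) u v)

  _·_ : Triple → Triple → Triple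
  [ x , y , z ] · [ x' , y' , z' ] =
    [ zipWith _+F_ x x' , zipWith _+F_ y y' ,
      (((z +F z') +F ⟨ x , y' ⟩) +F ⌊ f y y' ⌋F) ]

-- The finitely presented group M_n, as a quotient (setoid) of the free
-- monoid on generators and their formal inverses by the congruence
-- generated by free cancellation and the defining relations.

data Gen (n : ℕ) : Set where
  a : Fin n → Gen n
  b : Fin n → Gen n
  c : Gen n

-- a letter is a generator together with an exponent sign
-- (false = g, true = g⁻¹)
Word : ℕ → Set
Word n = List (Gen n × Bool)

module Presentation (p : ℕ) (n : ℕ) where

  gen : Gen n → Word n
  gen g = (g , false) ∷ []

  invW : Word n → Word n
  invW w = reverse (map (λ { (g , s) → (g , not s) }) w)

  powW : Word n → ℕ → Word n
  powW w zero = []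
  powW w (suc k) = w ++ powW w k

  comm : Word n → Word n → Word n
  comm u v = invW u ++ invW v ++ u ++ v

  data Relation : Word n → Word n → Set where
    [ai,aj]  : ∀ i j → Relation (comm (gen (a i)) (gen (a j))) []
    [bi,bj]  : ∀ i j → Relation (comm (gen (b i)) (gen (b j))) []
    [ai,bj]  : ∀ i j → ¬ (i ≡ j) → Relation (comm (gen (a i)) (gen (b j))) []
    [ai,c]   : ∀ i → Relation (comm (gen (a i)) (gen c)) []
    [bi,c]   : ∀ i → Relation (comm (gen (b i)) (gen c)) []
    [ai,bi]  : ∀ i → Relation (comm (gen (a i)) (gen (b i))) (gen c)
    ai^p     : ∀ i → Relation (powW (gen (a i)) p) []
    c^p      :       Relation (powW (gen c) p) []
    bi^p     : ∀ i → Relation (powW (gen (b i)) p) (gen c)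

  data _∼_ : Word n → Word n → Set where
    ∼-refl  : ∀ {u} → u ∼ u
    ∼-sym   : ∀ {u v} → u ∼ v → v ∼ u
    ∼-trans : ∀ {u v w} → u ∼ v → v ∼ w → u ∼ w
    ∼-ctx   : ∀ l {u v} r → u ∼ v → (l ++ u ++ r) ∼ (l ++ v ++ r)
    ∼-free  : ∀ g s → ((g , s) ∷ (g , not s) ∷ []) ∼ []
    ∼-rel   : ∀ {u v} → Relation u v → u ∼ v

  M : RawGroup 0ℓ 0ℓ
  M = record
    { Carrier = Word n
    ; _≈_     = _∼_
    ; _∙_     = _++_
    ; ε       = []
    ; _⁻¹     = invW
    }

GRaw : (p : ℕ) (pr : Prime p) (n : ℕ) →
       HeisenbergLike.Triple p pr n →
       (HeisenbergLike.Triple p pr n → HeisenbergLike.Triple p pr n) →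
       RawGroup 0ℓ 0ℓ
GRaw p pr n e inv = record
  { Carrier = Triple
  ; _≈_     = _≡_
  ; _∙_     = _·_
  ; ε       = e
  ; _⁻¹     = inv
  }
  where open HeisenbergLike p pr n

{-# OPTIONS --safe #-}
module Submission where

-- The z-coordinate of a product adds the bilinear term ⟨x, y′⟩ and the number f(y, y′) of carries
-- in the coordinatewise addition y + y′ of residues. Carries form a 2-cocycle,
-- f(y, y′) + f(y + y′, y″) = f(y′, y″) + f(y, y′ + y″), since both sides count the carries of
-- y + y′ + y″; this is exactly what associativity needs, and the other group laws are routine.
-- The elements aᵢ = [eᵢ, 0, 0], bᵢ = [0, eᵢ, 0] and c = [0, 0, 1] satisfy the relations of Mₙ
-- (bᵢᵖ = c because p steps of bᵢ produce exactly one carry), so evaluating words is a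
-- homomorphism Mₙ → G. Conversely, every word equals in Mₙ the normal form
-- b₁^y₁ a₁^x₁ ⋯ bₙ^yₙ aₙ^xₙ c^z of its value, because left multiplication by a generator can be
-- pushed through a normal form using the defining relations alone. Hence the normal form map
-- G → Mₙ is an isomorphism, inverse to evaluation.

open import Defs
open import Level using (0ℓ)
open import Data.Nat using (ℕ; zero; suc; _+_; _*_; _∸_; _/_; _%_; _≤_; NonZero; >-nonZero⁻¹; nonTrivial⇒n>1)
open import Data.Nat.Properties
  using (+-comm; +-assoc; +-identityʳ; *-comm; *-identityˡ; *-distribʳ-+; m+[n∸m]≡n; <⇒≤; +-commutativeSemigroup)
open import Data.Nat.DivMod
  using (_mod_; m%n<n; m<n⇒m%n≡m; %-distribˡ-+; %-distribˡ-*; n%n≡0; m≡m%n+[m/n]*n; /-congˡ;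
         +-distrib-/-∣ʳ; m*n/n≡m; m<n⇒m/n≡0; 0/n≡0; n/n≡1)
open import Data.Nat.Divisibility using (divides)
open import Data.Nat.Primality using (Prime; prime⇒nonZero; prime⇒nonTrivial)
open import Data.Fin using (Fin; toℕ) renaming (zero to fz; suc to fs)
open import Data.Fin.Properties using (toℕ-injective; toℕ-fromℕ<; toℕ<n; suc-injective)
open import Function using (_∘_)
open import Data.Empty using (⊥-elim)
open import Data.Vec using (Vec; []; _∷_; zipWith; replicate; foldr)
import Data.Vec as V
open import Data.Vec.Relation.Binary.Pointwise.Inductive
  using (Pointwise-≡⇒≡; zipWith-assoc; zipWith-comm; zipWith-identityˡ; zipWith-identityʳ)
open import Data.Product using (Σ; Σ-syntax; _×_; _,_; map₁)
open import Data.Bool using (Bool; false; true; not)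
open import Data.List using ([]; _∷_; _++_; map)
open import Data.List.Properties using (++-identityʳ; ++-assoc; map-++; unfold-reverse)
open import Relation.Binary.Bundles using (Setoid)
open import Relation.Binary.PropositionalEquality
  using (_≡_; _≢_; refl; sym; trans; cong; cong₂; subst; subst₂; isEquivalence; module ≡-Reasoning)
open import Algebra.Bundles using (CommutativeMonoid; Group)
open import Algebra.Structures using (IsGroup)
open import Algebra.Morphism.Structures using (module GroupMorphisms)
open import Algebra.Properties.CommutativeSemigroup +-commutativeSemigroup
  using (xy∙z≈xz∙y; xy∙z≈yz∙x) renaming (interchange to +-interchange)
import Algebra.Solver.CommutativeMonoid as CommutativeMonoidSolver

[m+k]/n≡m/n+[m%n+k]/n : ∀ m k n .{{_ : NonZero n}} → (m + k) / n ≡ m / n + (m % n + k) / n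
[m+k]/n≡m/n+[m%n+k]/n m k n = begin
  (m + k) / n                       ≡⟨ /-congˡ (cong (_+ k) (m≡m%n+[m/n]*n m n)) ⟩
  (m % n + m / n * n + k) / n       ≡⟨ /-congˡ (xy∙z≈xz∙y (m % n) (m / n * n) k) ⟩
  (m % n + k + m / n * n) / n       ≡⟨ +-distrib-/-∣ʳ (m % n + k) (divides (m / n) refl) ⟩
  (m % n + k) / n + m / n * n / n   ≡⟨ cong ((m % n + k) / n +_) (m*n/n≡m (m / n) n) ⟩
  (m % n + k) / n + m / n           ≡⟨ +-comm _ (m / n) ⟩
  m / n + (m % n + k) / n           ∎
  where open ≡-Reasoning

module Residues (p : ℕ) .{{_ : NonZero p}} where

  F : Set
  F = Fin p

  ⌊_⌋ : ℕ → F
  ⌊ m ⌋ = m mod p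

  infix  8 -F_
  infixl 7 _*F_
  infixl 6 _+F_

  _+F_ _*F_ : F → F → F
  α +F β = ⌊ toℕ α + toℕ β ⌋
  α *F β = ⌊ toℕ α * toℕ β ⌋

  0F 1F : F
  0F = ⌊ 0 ⌋
  1F = ⌊ 1 ⌋

  -F_ : F → F
  -F α = ⌊ p ∸ toℕ α ⌋

  toℕ-⌊⌋ : ∀ m → toℕ ⌊ m ⌋ ≡ m % p
  toℕ-⌊⌋ m = toℕ-fromℕ< (m%n<n m p)

  ⌊toℕ⌋ : ∀ α → ⌊ toℕ α ⌋ ≡ α
  ⌊toℕ⌋ α = toℕ-injective (trans (toℕ-⌊⌋ (toℕ α)) (m<n⇒m%n≡m (toℕ<n α)))

  ⌊⌋-cong : ∀ {m n} → m % p ≡ n % p → ⌊ m ⌋ ≡ ⌊ n ⌋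
  ⌊⌋-cong {m} {n} eq = toℕ-injective (trans (toℕ-⌊⌋ m) (trans eq (sym (toℕ-⌊⌋ n))))

  ⌊⌋-+ : ∀ m n → ⌊ m + n ⌋ ≡ ⌊ m ⌋ +F ⌊ n ⌋
  ⌊⌋-+ m n = ⌊⌋-cong (trans (%-distribˡ-+ m n p)
    (sym (cong₂ (λ i j → (i + j) % p) (toℕ-⌊⌋ m) (toℕ-⌊⌋ n))))

  ⌊⌋-* : ∀ m n → ⌊ m * n ⌋ ≡ ⌊ m ⌋ *F ⌊ n ⌋
  ⌊⌋-* m n = ⌊⌋-cong (trans (%-distribˡ-* m n p)
    (sym (cong₂ (λ i j → (i * j) % p) (toℕ-⌊⌋ m) (toℕ-⌊⌋ n))))

  toℕ-0F : toℕ 0F ≡ 0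
  toℕ-0F = trans (toℕ-⌊⌋ 0) (m<n⇒m%n≡m (>-nonZero⁻¹ p))

  ⌊p⌋≡0F : ⌊ p ⌋ ≡ 0F
  ⌊p⌋≡0F = toℕ-injective (trans (toℕ-⌊⌋ p) (trans (n%n≡0 p) (sym toℕ-0F)))

  +F-comm : ∀ α β → α +F β ≡ β +F α
  +F-comm α β = cong ⌊_⌋ (+-comm (toℕ α) (toℕ β))

  +F-assoc : ∀ α β γ → (α +F β) +F γ ≡ α +F (β +F γ)
  +F-assoc α β γ = begin
    (α +F β) +F γ           ≡⟨ cong (α +F β +F_) (⌊toℕ⌋ γ) ⟨
    ⌊ k + l ⌋ +F ⌊ m ⌋      ≡⟨ ⌊⌋-+ (k + l) m ⟨
    ⌊ k + l + m ⌋           ≡⟨ cong ⌊_⌋ (+-assoc k l m) ⟩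
    ⌊ k + (l + m) ⌋         ≡⟨ ⌊⌋-+ k (l + m) ⟩
    ⌊ k ⌋ +F (β +F γ)       ≡⟨ cong (_+F (β +F γ)) (⌊toℕ⌋ α) ⟩
    α +F (β +F γ)           ∎
    where open ≡-Reasoning
          k = toℕ α; l = toℕ β; m = toℕ γ

  +F-identityˡ : ∀ α → 0F +F α ≡ α
  +F-identityˡ α = begin
    0F +F α          ≡⟨ cong (0F +F_) (⌊toℕ⌋ α) ⟨
    ⌊ 0 ⌋ +F ⌊ k ⌋   ≡⟨ ⌊⌋-+ 0 k ⟨
    ⌊ k ⌋            ≡⟨ ⌊toℕ⌋ α ⟩
    α                ∎
    where open ≡-Reasoning
          k = toℕ α

  +F-identityʳ : ∀ α → α +F 0F ≡ α
  +F-identityʳ α = trans (+F-comm α 0F) (+F-identityˡ α)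

  +F-inverseʳ : ∀ α → α +F -F α ≡ 0F
  +F-inverseʳ α = begin
    α +F -F α            ≡⟨ cong (_+F -F α) (⌊toℕ⌋ α) ⟨
    ⌊ k ⌋ +F ⌊ p ∸ k ⌋   ≡⟨ ⌊⌋-+ k (p ∸ k) ⟨
    ⌊ k + (p ∸ k) ⌋      ≡⟨ cong ⌊_⌋ (m+[n∸m]≡n (<⇒≤ (toℕ<n α))) ⟩
    ⌊ p ⌋                ≡⟨ ⌊p⌋≡0F ⟩
    0F                   ∎
    where open ≡-Reasoning
          k = toℕ α

  *F-comm : ∀ α β → α *F β ≡ β *F α
  *F-comm α β = cong ⌊_⌋ (*-comm (toℕ α) (toℕ β))

  *F-distribʳ : ∀ α β γ → (α +F β) *F γ ≡ α *F γ +F β *F γ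
  *F-distribʳ α β γ = begin
    (α +F β) *F γ              ≡⟨ cong ((α +F β) *F_) (⌊toℕ⌋ γ) ⟨
    ⌊ k + l ⌋ *F ⌊ m ⌋         ≡⟨ ⌊⌋-* (k + l) m ⟨
    ⌊ (k + l) * m ⌋            ≡⟨ cong ⌊_⌋ (*-distribʳ-+ m k l) ⟩
    ⌊ k * m + l * m ⌋          ≡⟨ ⌊⌋-+ (k * m) (l * m) ⟩
    α *F γ +F β *F γ           ∎
    where open ≡-Reasoning
          k = toℕ α; l = toℕ β; m = toℕ γ

  *F-distribˡ : ∀ α β γ → α *F (β +F γ) ≡ α *F β +F α *F γ
  *F-distribˡ α β γ = begin
    α *F (β +F γ)        ≡⟨ *F-comm α (β +F γ) ⟩
    (β +F γ) *F α        ≡⟨ *F-distribʳ β γ α ⟩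
    β *F α +F γ *F α     ≡⟨ cong₂ _+F_ (*F-comm β α) (*F-comm γ α) ⟩
    α *F β +F α *F γ     ∎
    where open ≡-Reasoning

  *F-zeroˡ : ∀ α → 0F *F α ≡ 0F
  *F-zeroˡ α = trans (cong (0F *F_) (sym (⌊toℕ⌋ α))) (sym (⌊⌋-* 0 (toℕ α)))

  *F-zeroʳ : ∀ α → α *F 0F ≡ 0F
  *F-zeroʳ α = trans (*F-comm α 0F) (*F-zeroˡ α)

  *F-identityˡ : ∀ α → 1F *F α ≡ α
  *F-identityˡ α = trans (cong (1F *F_) (sym (⌊toℕ⌋ α)))
    (trans (sym (⌊⌋-* 1 (toℕ α))) (trans (cong ⌊_⌋ (*-identityˡ (toℕ α))) (⌊toℕ⌋ α)))

  +F-commutativeMonoid : CommutativeMonoid 0ℓ 0ℓ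
  +F-commutativeMonoid = record
    { Carrier = F ; _≈_ = _≡_ ; _∙_ = _+F_ ; ε = 0F
    ; isCommutativeMonoid = record
      { isMonoid = record
        { isSemigroup = record
          { isMagma = record { isEquivalence = isEquivalence ; ∙-cong = cong₂ _+F_ }
          ; assoc = +F-assoc }
        ; identity = +F-identityˡ , +F-identityʳ }
      ; comm = +F-comm } }

  open import Algebra.Properties.CommutativeSemigroup
    (CommutativeMonoid.commutativeSemigroup +F-commutativeMonoid)
    using () renaming (interchange to +F-interchange)

  private variable m : ℕ

  0v : Vec F m
  0v = replicate _ 0F

  infix  8 -V_
  infixl 6 _+V_

  _+V_ : Vec F m → Vec F m → Vec F m
  _+V_ = zipWith _+F_

  -V_ : Vec F m → Vec F m
  -V_ = V.map -F_

  +V-assoc : ∀ (u v w : Vec F m) → (u +V v) +V w ≡ u +V (v +V w)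
  +V-assoc u v w = Pointwise-≡⇒≡ (zipWith-assoc +F-assoc u v w)

  +V-comm : ∀ (u v : Vec F m) → u +V v ≡ v +V u
  +V-comm u v = Pointwise-≡⇒≡ (zipWith-comm +F-comm u v)

  +V-identityˡ : ∀ (u : Vec F m) → 0v +V u ≡ u
  +V-identityˡ u = Pointwise-≡⇒≡ (zipWith-identityˡ +F-identityˡ u)

  +V-identityʳ : ∀ (u : Vec F m) → u +V 0v ≡ u
  +V-identityʳ u = Pointwise-≡⇒≡ (zipWith-identityʳ +F-identityʳ u)

  +V-inverseʳ : ∀ (u : Vec F m) → u +V -V u ≡ 0v
  +V-inverseʳ []      = refl
  +V-inverseʳ (α ∷ u) = cong₂ _∷_ (+F-inverseʳ α) (+V-inverseʳ u)

  +V-inverseˡ : ∀ (u : Vec F m) → -V u +V u ≡ 0v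
  +V-inverseˡ u = trans (+V-comm (-V u) u) (+V-inverseʳ u)

  -- ⟨_,_⟩ and carries unfold to the ⟨_,_⟩ and f of HeisenbergLike, so they apply to its _·_.
  ⟨_,_⟩ : Vec F m → Vec F m → F
  ⟨ u , v ⟩ = foldr (λ _ → F) _+F_ 0F (zipWith _*F_ u v)

  ⟨0v,-⟩≡0F : ∀ (v : Vec F m) → ⟨ 0v , v ⟩ ≡ 0F
  ⟨0v,-⟩≡0F []      = refl
  ⟨0v,-⟩≡0F (β ∷ v) = trans (cong₂ _+F_ (*F-zeroˡ β) (⟨0v,-⟩≡0F v)) (+F-identityˡ 0F)

  ⟨-,0v⟩≡0F : ∀ (u : Vec F m) → ⟨ u , 0v ⟩ ≡ 0F
  ⟨-,0v⟩≡0F []      = refl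
  ⟨-,0v⟩≡0F (α ∷ u) = trans (cong₂ _+F_ (*F-zeroʳ α) (⟨-,0v⟩≡0F u)) (+F-identityˡ 0F)

  ⟨⟩-distribʳ : ∀ (u u′ v : Vec F m) → ⟨ u +V u′ , v ⟩ ≡ ⟨ u , v ⟩ +F ⟨ u′ , v ⟩
  ⟨⟩-distribʳ []      []        []      = sym (+F-identityˡ 0F)
  ⟨⟩-distribʳ (α ∷ u) (α′ ∷ u′) (β ∷ v) = begin
    (α +F α′) *F β +F ⟨ u +V u′ , v ⟩                      ≡⟨ cong₂ _+F_ (*F-distribʳ α α′ β) (⟨⟩-distribʳ u u′ v) ⟩
    (α *F β +F α′ *F β) +F (⟨ u , v ⟩ +F ⟨ u′ , v ⟩)       ≡⟨ +F-interchange (α *F β) (α′ *F β) ⟨ u , v ⟩ ⟨ u′ , v ⟩ ⟩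
    (α *F β +F ⟨ u , v ⟩) +F (α′ *F β +F ⟨ u′ , v ⟩)       ∎
    where open ≡-Reasoning

  ⟨⟩-distribˡ : ∀ (u v v′ : Vec F m) → ⟨ u , v +V v′ ⟩ ≡ ⟨ u , v ⟩ +F ⟨ u , v′ ⟩
  ⟨⟩-distribˡ []      []      []        = sym (+F-identityˡ 0F)
  ⟨⟩-distribˡ (α ∷ u) (β ∷ v) (β′ ∷ v′) = begin
    α *F (β +F β′) +F ⟨ u , v +V v′ ⟩                      ≡⟨ cong₂ _+F_ (*F-distribˡ α β β′) (⟨⟩-distribˡ u v v′) ⟩
    (α *F β +F α *F β′) +F (⟨ u , v ⟩ +F ⟨ u , v′ ⟩)       ≡⟨ +F-interchange (α *F β) (α *F β′) ⟨ u , v ⟩ ⟨ u , v′ ⟩ ⟩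
    (α *F β +F ⟨ u , v ⟩) +F (α *F β′ +F ⟨ u , v′ ⟩)       ∎
    where open ≡-Reasoning

  carry : F → F → ℕ
  carry α β = (toℕ α + toℕ β) / p

  carries : Vec F m → Vec F m → ℕ
  carries u v = V.sum (zipWith carry u v)

  carry-comm : ∀ α β → carry α β ≡ carry β α
  carry-comm α β = /-congˡ (+-comm (toℕ α) (toℕ β))

  carry-0F : ∀ β → carry 0F β ≡ 0
  carry-0F β = trans (/-congˡ (cong (_+ toℕ β) toℕ-0F)) (m<n⇒m/n≡0 (toℕ<n β))

  carry-+F : ∀ α β γ → carry α β + carry (α +F β) γ ≡ (toℕ α + toℕ β + toℕ γ) / p
  carry-+F α β γ = trans (cong (λ k → carry α β + (k + toℕ γ) / p) (toℕ-⌊⌋ (toℕ α + toℕ β)))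
    (sym ([m+k]/n≡m/n+[m%n+k]/n (toℕ α + toℕ β) (toℕ γ) p))

  carry-cocycle : ∀ α β γ → carry α β + carry (α +F β) γ ≡ carry β γ + carry α (β +F γ)
  carry-cocycle α β γ = begin
    carry α β + carry (α +F β) γ      ≡⟨ carry-+F α β γ ⟩
    (toℕ α + toℕ β + toℕ γ) / p       ≡⟨ /-congˡ (xy∙z≈yz∙x (toℕ α) (toℕ β) (toℕ γ)) ⟩
    (toℕ β + toℕ γ + toℕ α) / p       ≡⟨ carry-+F β γ α ⟨
    carry β γ + carry (β +F γ) α      ≡⟨ cong (carry β γ +_) (carry-comm (β +F γ) α) ⟩
    carry β γ + carry α (β +F γ)      ∎
    where open ≡-Reasoning

  carries-comm : ∀ (u v : Vec F m) → carries u v ≡ carries v u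
  carries-comm []      []      = refl
  carries-comm (α ∷ u) (β ∷ v) = cong₂ _+_ (carry-comm α β) (carries-comm u v)

  carries-0v : ∀ (v : Vec F m) → carries 0v v ≡ 0
  carries-0v []      = refl
  carries-0v (β ∷ v) = cong₂ _+_ (carry-0F β) (carries-0v v)

  carries-cocycle : ∀ (u v w : Vec F m) →
                    carries u v + carries (u +V v) w ≡ carries v w + carries u (v +V w)
  carries-cocycle []      []      []      = refl
  carries-cocycle (α ∷ u) (β ∷ v) (γ ∷ w) = begin
    (carry α β + carries u v) + (carry (α +F β) γ + carries (u +V v) w)
      ≡⟨ +-interchange (carry α β) (carries u v) _ _ ⟩
    (carry α β + carry (α +F β) γ) + (carries u v + carries (u +V v) w)
      ≡⟨ cong₂ _+_ (carry-cocycle α β γ) (carries-cocycle u v w) ⟩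
    (carry β γ + carry α (β +F γ)) + (carries v w + carries u (v +V w))
      ≡⟨ +-interchange (carry β γ) _ (carries v w) _ ⟩
    (carry β γ + carries v w) + (carry α (β +F γ) + carries u (v +V w))
      ∎
    where open ≡-Reasoning

  single : Fin m → F → Vec F m
  single fz     α = α ∷ 0v
  single (fs i) α = 0F ∷ single i α

  single-+F : ∀ (i : Fin m) α β → single i α +V single i β ≡ single i (α +F β)
  single-+F fz     α β = cong ((α +F β) ∷_) (+V-identityˡ 0v)
  single-+F (fs i) α β = cong₂ _∷_ (+F-identityˡ 0F) (single-+F i α β)

  single-0F : ∀ (i : Fin m) → single i 0F ≡ 0v
  single-0F fz     = refl
  single-0F (fs i) = cong (0F ∷_) (single-0F i)

  single-⌊p⌋ : ∀ (i : Fin m) → single i ⌊ p ⌋ ≡ 0v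
  single-⌊p⌋ i = trans (cong (single i) ⌊p⌋≡0F) (single-0F i)

  ⟨single,single⟩ : ∀ (i : Fin m) α β → ⟨ single i α , single i β ⟩ ≡ α *F β
  ⟨single,single⟩ {suc m} fz α β = trans (cong (α *F β +F_) (⟨0v,-⟩≡0F {m} 0v)) (+F-identityʳ (α *F β))
  ⟨single,single⟩ (fs i) α β = trans (cong₂ _+F_ (*F-zeroˡ 0F) (⟨single,single⟩ i α β)) (+F-identityˡ (α *F β))

  ⟨single,single⟩-≢ : ∀ (i j : Fin m) → i ≢ j → ∀ α β → ⟨ single i α , single j β ⟩ ≡ 0F
  ⟨single,single⟩-≢ fz     fz     i≢j α β = ⊥-elim (i≢j refl)
  ⟨single,single⟩-≢ fz     (fs j) i≢j α β = trans (cong₂ _+F_ (*F-zeroʳ α) (⟨0v,-⟩≡0F (single j β))) (+F-identityˡ 0F)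
  ⟨single,single⟩-≢ (fs i) fz     i≢j α β = trans (cong₂ _+F_ (*F-zeroˡ β) (⟨-,0v⟩≡0F (single i α))) (+F-identityˡ 0F)
  ⟨single,single⟩-≢ (fs i) (fs j) i≢j α β =
    trans (cong₂ _+F_ (*F-zeroˡ 0F) (⟨single,single⟩-≢ i j (i≢j ∘ cong fs) α β)) (+F-identityˡ 0F)

  carries-single : ∀ (i : Fin m) α β → carries (single i α) (single i β) ≡ carry α β
  carries-single {suc m} fz α β = trans (cong (carry α β +_) (carries-0v {m} 0v)) (+-identityʳ (carry α β))
  carries-single (fs i) α β = trans (cong (_+ carries (single i α) (single i β)) (carry-0F 0F)) (carries-single i α β)

module _ {ℓ₁ ℓ₂} (𝔾 : Group ℓ₁ ℓ₂) where

  open Group 𝔾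
  open import Algebra.Properties.Group 𝔾 using (\\-leftDividesʳ)
  open import Relation.Binary.Reasoning.Setoid setoid

  commutator≈ : ∀ g h k → h ∙ g ∙ k ≈ g ∙ h → g ⁻¹ ∙ (h ⁻¹ ∙ (g ∙ h)) ≈ k
  commutator≈ g h k hgk≈gh = begin
    g ⁻¹ ∙ (h ⁻¹ ∙ (g ∙ h))         ≈⟨ ∙-congˡ (∙-congˡ hgk≈gh) ⟨
    g ⁻¹ ∙ (h ⁻¹ ∙ (h ∙ g ∙ k))     ≈⟨ ∙-congˡ (∙-congˡ (assoc h g k)) ⟩
    g ⁻¹ ∙ (h ⁻¹ ∙ (h ∙ (g ∙ k)))   ≈⟨ ∙-congˡ (\\-leftDividesʳ h (g ∙ k)) ⟩
    g ⁻¹ ∙ (g ∙ k)                  ≈⟨ \\-leftDividesʳ g k ⟩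
    k                               ∎

module Heisenberg (p : ℕ) (pr : Prime p) where

  private instance
    p≢0 : NonZero p
    p≢0 = prime⇒nonZero pr

  open Residues p public
  open HeisenbergLike using ([_,_,_])
  open CommutativeMonoidSolver +F-commutativeMonoid using (solve; _⊜_) renaming (_⊕_ to infixl 6 _⊕_)

  private variable m : ℕ

  G : ℕ → Set
  G m = HeisenbergLike.Triple p pr m

  infixl 7 _∙_
  _∙_ : G m → G m → G m
  _∙_ {m} = HeisenbergLike._·_ p pr m

  triple-≡ : ∀ {x x′ y y′ : Vec F m} {z z′} → x ≡ x′ → y ≡ y′ → z ≡ z′ →
             _≡_ {A = G m} [ x , y , z ] [ x′ , y′ , z′ ]
  triple-≡ refl refl refl = refl

  ζ : F → G m
  ζ γ = [ 0v , 0v , γ ]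

  ε : G m
  ε = ζ 0F

  -- The z-coordinate solves z + w + ⟨x, -y⟩ + f(y, -y) = 0, as ⟨x, -y⟩ = -⟨x, y⟩.
  _⁻¹ : G m → G m
  [ x , y , z ] ⁻¹ = [ -V x , -V y , ⟨ x , y ⟩ +F -F (z +F ⌊ carries y (-V y) ⌋) ]

  ∙-assoc : ∀ (s t u : G m) → (s ∙ t) ∙ u ≡ s ∙ (t ∙ u)
  ∙-assoc [ x₁ , y₁ , z₁ ] [ x₂ , y₂ , z₂ ] [ x₃ , y₃ , z₃ ] =
    triple-≡ (+V-assoc x₁ x₂ x₃) (+V-assoc y₁ y₂ y₃) (begin
      (z₁ +F z₂ +F A₁₂ +F ⌊ c₁₂ ⌋ +F z₃) +F ⟨ x₁ +V x₂ , y₃ ⟩ +F ⌊ c₁₂,₃ ⌋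
        ≡⟨ cong (λ σ → (z₁ +F z₂ +F A₁₂ +F ⌊ c₁₂ ⌋ +F z₃) +F σ +F ⌊ c₁₂,₃ ⌋) (⟨⟩-distribʳ x₁ x₂ y₃) ⟩
      (z₁ +F z₂ +F A₁₂ +F ⌊ c₁₂ ⌋ +F z₃) +F (A₁₃ +F A₂₃) +F ⌊ c₁₂,₃ ⌋
        ≡⟨ solve 8 (λ z₁ z₂ z₃ σ τ υ φ ψ → (z₁ ⊕ z₂ ⊕ σ ⊕ φ ⊕ z₃) ⊕ (τ ⊕ υ) ⊕ ψ ⊜ Z z₁ z₂ z₃ σ τ υ ⊕ (φ ⊕ ψ))
             refl z₁ z₂ z₃ A₁₂ A₁₃ A₂₃ ⌊ c₁₂ ⌋ ⌊ c₁₂,₃ ⌋ ⟩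
      Z′ +F (⌊ c₁₂ ⌋ +F ⌊ c₁₂,₃ ⌋)
        ≡⟨ cong (Z′ +F_) carries-cocycleF ⟩
      Z′ +F (⌊ c₂₃ ⌋ +F ⌊ c₁,₂₃ ⌋)
        ≡⟨ solve 8 (λ z₁ z₂ z₃ σ τ υ φ ψ → Z z₁ z₂ z₃ σ τ υ ⊕ (φ ⊕ ψ) ⊜ (z₁ ⊕ (z₂ ⊕ z₃ ⊕ υ ⊕ φ)) ⊕ (σ ⊕ τ) ⊕ ψ)
             refl z₁ z₂ z₃ A₁₂ A₁₃ A₂₃ ⌊ c₂₃ ⌋ ⌊ c₁,₂₃ ⌋ ⟩
      (z₁ +F (z₂ +F z₃ +F A₂₃ +F ⌊ c₂₃ ⌋)) +F (A₁₂ +F A₁₃) +F ⌊ c₁,₂₃ ⌋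
        ≡⟨ cong (λ σ → (z₁ +F (z₂ +F z₃ +F A₂₃ +F ⌊ c₂₃ ⌋)) +F σ +F ⌊ c₁,₂₃ ⌋) (⟨⟩-distribˡ x₁ y₂ y₃) ⟨
      (z₁ +F (z₂ +F z₃ +F A₂₃ +F ⌊ c₂₃ ⌋)) +F ⟨ x₁ , y₂ +V y₃ ⟩ +F ⌊ c₁,₂₃ ⌋
        ∎)
    where
      open ≡-Reasoning
      A₁₂ = ⟨ x₁ , y₂ ⟩; A₁₃ = ⟨ x₁ , y₃ ⟩; A₂₃ = ⟨ x₂ , y₃ ⟩
      c₁₂ = carries y₁ y₂; c₁₂,₃ = carries (y₁ +V y₂) y₃
      c₂₃ = carries y₂ y₃; c₁,₂₃ = carries y₁ (y₂ +V y₃)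
      Z = λ z₁ z₂ z₃ σ τ υ → z₁ ⊕ z₂ ⊕ z₃ ⊕ σ ⊕ (τ ⊕ υ)
      Z′ = z₁ +F z₂ +F z₃ +F A₁₂ +F (A₁₃ +F A₂₃)
      carries-cocycleF : ⌊ c₁₂ ⌋ +F ⌊ c₁₂,₃ ⌋ ≡ ⌊ c₂₃ ⌋ +F ⌊ c₁,₂₃ ⌋
      carries-cocycleF = trans (sym (⌊⌋-+ c₁₂ c₁₂,₃))
        (trans (cong ⌊_⌋ (carries-cocycle y₁ y₂ y₃)) (⌊⌋-+ c₂₃ c₁,₂₃))

  ζ-∙ : ∀ γ (x y : Vec F m) z → ζ γ ∙ [ x , y , z ] ≡ [ x , y , γ +F z ]
  ζ-∙ γ x y z = triple-≡ (+V-identityˡ x) (+V-identityˡ y) (begin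
    γ +F z +F ⟨ 0v , y ⟩ +F ⌊ carries 0v y ⌋   ≡⟨ cong₂ (λ σ k → γ +F z +F σ +F ⌊ k ⌋) (⟨0v,-⟩≡0F y) (carries-0v y) ⟩
    γ +F z +F 0F +F 0F                         ≡⟨ trans (+F-identityʳ _) (+F-identityʳ _) ⟩
    γ +F z                                     ∎)
    where open ≡-Reasoning

  ∙-identityˡ : ∀ (t : G m) → ε ∙ t ≡ t
  ∙-identityˡ [ x , y , z ] = trans (ζ-∙ 0F x y z) (triple-≡ refl refl (+F-identityˡ z))

  ∙-identityʳ : ∀ (t : G m) → t ∙ ε ≡ t
  ∙-identityʳ [ x , y , z ] = triple-≡ (+V-identityʳ x) (+V-identityʳ y) (begin
    z +F 0F +F ⟨ x , 0v ⟩ +F ⌊ carries y 0v ⌋   ≡⟨ cong₂ (λ σ k → z +F 0F +F σ +F ⌊ k ⌋) (⟨-,0v⟩≡0F x)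
                                                          (trans (carries-comm y 0v) (carries-0v y)) ⟩
    z +F 0F +F 0F +F 0F                         ≡⟨ trans (+F-identityʳ _) (trans (+F-identityʳ _) (+F-identityʳ z)) ⟩
    z                                           ∎)
    where open ≡-Reasoning

  ∙-inverseʳ : ∀ (t : G m) → t ∙ t ⁻¹ ≡ ε
  ∙-inverseʳ [ x , y , z ] = triple-≡ (+V-inverseʳ x) (+V-inverseʳ y) (begin
    z +F (A +F -F (z +F Φ)) +F B +F Φ    ≡⟨ solve 5 (λ z σ ν τ φ → z ⊕ (σ ⊕ ν) ⊕ τ ⊕ φ ⊜ (z ⊕ φ ⊕ ν) ⊕ (σ ⊕ τ))
                                              refl z A (-F (z +F Φ)) B Φ ⟩
    (z +F Φ +F -F (z +F Φ)) +F (A +F B)  ≡⟨ cong₂ _+F_ (+F-inverseʳ (z +F Φ)) (sym (⟨⟩-distribˡ x y (-V y))) ⟩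
    0F +F ⟨ x , y +V -V y ⟩              ≡⟨ trans (+F-identityˡ _) (cong ⟨ x ,_⟩ (+V-inverseʳ y)) ⟩
    ⟨ x , 0v ⟩                           ≡⟨ ⟨-,0v⟩≡0F x ⟩
    0F                                   ∎)
    where open ≡-Reasoning
          A = ⟨ x , y ⟩; B = ⟨ x , -V y ⟩; Φ = ⌊ carries y (-V y) ⌋

  ∙-inverseˡ : ∀ (t : G m) → t ⁻¹ ∙ t ≡ ε
  ∙-inverseˡ [ x , y , z ] = triple-≡ (+V-inverseˡ x) (+V-inverseˡ y) (begin
    A +F -F (z +F Φ) +F z +F B +F ⌊ carries (-V y) y ⌋
      ≡⟨ cong (λ k → A +F -F (z +F Φ) +F z +F B +F ⌊ k ⌋) (carries-comm (-V y) y) ⟩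
    A +F -F (z +F Φ) +F z +F B +F Φ
      ≡⟨ solve 5 (λ z σ ν τ φ → σ ⊕ ν ⊕ z ⊕ τ ⊕ φ ⊜ (z ⊕ φ ⊕ ν) ⊕ (σ ⊕ τ)) refl z A (-F (z +F Φ)) B Φ ⟩
    (z +F Φ +F -F (z +F Φ)) +F (A +F B)
      ≡⟨ cong₂ _+F_ (+F-inverseʳ (z +F Φ)) (sym (⟨⟩-distribʳ x (-V x) y)) ⟩
    0F +F ⟨ x +V -V x , y ⟩
      ≡⟨ trans (+F-identityˡ _) (cong ⟨_, y ⟩ (+V-inverseʳ x)) ⟩
    ⟨ 0v , y ⟩
      ≡⟨ ⟨0v,-⟩≡0F y ⟩
    0F
      ∎)
    where open ≡-Reasoning
          A = ⟨ x , y ⟩; B = ⟨ -V x , y ⟩; Φ = ⌊ carries y (-V y) ⌋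

  ∙-isGroup : IsGroup {A = G m} _≡_ _∙_ ε _⁻¹
  ∙-isGroup = record
    { isMonoid = record
      { isSemigroup = record
        { isMagma = record { isEquivalence = isEquivalence ; ∙-cong = cong₂ _∙_ }
        ; assoc = ∙-assoc }
      ; identity = ∙-identityˡ , ∙-identityʳ }
    ; inverse = ∙-inverseˡ , ∙-inverseʳ
    ; ⁻¹-cong = cong _⁻¹ }

  triple-comm : ∀ (x y x′ y′ : Vec F m) z z′ → ⟨ x , y′ ⟩ ≡ ⟨ x′ , y ⟩ →
                [ x , y , z ] ∙ [ x′ , y′ , z′ ] ≡ [ x′ , y′ , z′ ] ∙ [ x , y , z ]
  triple-comm x y x′ y′ z z′ eq = triple-≡ (+V-comm x x′) (+V-comm y y′)
    (cong₂ _+F_ (cong₂ _+F_ (+F-comm z z′) eq) (cong ⌊_⌋ (carries-comm y y′)))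

  ∙-ζ : ∀ (x y : Vec F m) z γ → [ x , y , z ] ∙ ζ γ ≡ [ x , y , z +F γ ]
  ∙-ζ x y z γ = trans (triple-comm x y 0v 0v z γ (trans (⟨-,0v⟩≡0F x) (sym (⟨0v,-⟩≡0F y))))
                      (trans (ζ-∙ γ x y z) (triple-≡ refl refl (+F-comm γ z)))

  ζ-∙-ζ : ∀ α β (t : G m) → ζ α ∙ (ζ β ∙ t) ≡ ζ (α +F β) ∙ t
  ζ-∙-ζ α β [ x , y , z ] = begin
    ζ α ∙ (ζ β ∙ [ x , y , z ])   ≡⟨ cong (ζ α ∙_) (ζ-∙ β x y z) ⟩
    ζ α ∙ [ x , y , β +F z ]      ≡⟨ ζ-∙ α x y (β +F z) ⟩
    [ x , y , α +F (β +F z) ]     ≡⟨ triple-≡ refl refl (+F-assoc α β z) ⟨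
    [ x , y , α +F β +F z ]       ≡⟨ ζ-∙ (α +F β) x y z ⟨
    ζ (α +F β) ∙ [ x , y , z ]    ∎
    where open ≡-Reasoning

  x-part-∙ : ∀ (x x′ : Vec F m) → [ x , 0v , 0F ] ∙ [ x′ , 0v , 0F ] ≡ [ x +V x′ , 0v , 0F ]
  x-part-∙ {m} x x′ = triple-≡ refl (+V-identityˡ 0v)
    (trans (cong₂ (λ σ k → 0F +F 0F +F σ +F ⌊ k ⌋) (⟨-,0v⟩≡0F x) (carries-0v {m} 0v))
           (trans (+F-identityʳ _) (trans (+F-identityʳ _) (+F-identityʳ 0F))))

  y-part-∙ : ∀ (y y′ : Vec F m) z z′ →
             [ 0v , y , z ] ∙ [ 0v , y′ , z′ ] ≡ [ 0v , y +V y′ , z +F z′ +F ⌊ carries y y′ ⌋ ]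
  y-part-∙ y y′ z z′ = triple-≡ (+V-identityˡ 0v) refl
    (cong (_+F ⌊ carries y y′ ⌋) (trans (cong (z +F z′ +F_) (⟨0v,-⟩≡0F y′)) (+F-identityʳ (z +F z′))))

  cons : F → F → G m → G (suc m)
  cons α β [ x , y , z ] = [ α ∷ x , β ∷ y , z ]

  cons-≡ : ∀ {α α′ β β′} {s s′ : G m} → α ≡ α′ → β ≡ β′ → s ≡ s′ → cons α β s ≡ cons α′ β′ s′
  cons-≡ refl refl refl = refl

  cons-∙-cons : ∀ α β α′ β′ (s s′ : G m) →
                cons α β s ∙ cons α′ β′ s′ ≡ cons (α +F α′) (β +F β′) (ζ (α *F β′ +F ⌊ carry β β′ ⌋) ∙ (s ∙ s′))
  cons-∙-cons α β α′ β′ [ x , y , z ] [ x′ , y′ , z′ ] = begin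
    [ (α +F α′) ∷ (x +V x′) , (β +F β′) ∷ (y +V y′) , z +F z′ +F (α *F β′ +F ⟨ x , y′ ⟩) +F ⌊ c₁ + c₂ ⌋ ]
      ≡⟨ triple-≡ refl refl (cong (z +F z′ +F (α *F β′ +F ⟨ x , y′ ⟩) +F_) (⌊⌋-+ c₁ c₂)) ⟩
    [ (α +F α′) ∷ (x +V x′) , (β +F β′) ∷ (y +V y′) , z +F z′ +F (α *F β′ +F ⟨ x , y′ ⟩) +F (⌊ c₁ ⌋ +F ⌊ c₂ ⌋) ]
      ≡⟨ triple-≡ refl refl (solve 6 (λ z z′ σ τ φ ψ → z ⊕ z′ ⊕ (σ ⊕ τ) ⊕ (φ ⊕ ψ) ⊜ σ ⊕ φ ⊕ (z ⊕ z′ ⊕ τ ⊕ ψ))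
                                refl z z′ (α *F β′) ⟨ x , y′ ⟩ ⌊ c₁ ⌋ ⌊ c₂ ⌋) ⟩
    cons (α +F α′) (β +F β′) [ x +V x′ , y +V y′ , γ +F (z +F z′ +F ⟨ x , y′ ⟩ +F ⌊ c₂ ⌋) ]
      ≡⟨ cong (cons (α +F α′) (β +F β′)) (ζ-∙ γ (x +V x′) (y +V y′) _) ⟨
    cons (α +F α′) (β +F β′) (ζ γ ∙ ([ x , y , z ] ∙ [ x′ , y′ , z′ ]))
      ∎
    where open ≡-Reasoning
          c₁ = carry β β′; c₂ = carries y y′; γ = α *F β′ +F ⌊ c₁ ⌋

  cons-ε-∙-cons : ∀ α β α′ β′ (s : G m) →
                  cons α β ε ∙ cons α′ β′ s ≡ cons (α +F α′) (β +F β′) (ζ (α *F β′ +F ⌊ carry β β′ ⌋) ∙ s)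
  cons-ε-∙-cons α β α′ β′ s = trans (cons-∙-cons α β α′ β′ ε s)
    (cong (λ t → cons (α +F α′) (β +F β′) (ζ (α *F β′ +F ⌊ carry β β′ ⌋) ∙ t)) (∙-identityˡ s))

  cons₀ : G m → G (suc m)
  cons₀ = cons 0F 0F

  cons₀-∙-cons : ∀ (t : G m) α β s → cons₀ t ∙ cons α β s ≡ cons α β (t ∙ s)
  cons₀-∙-cons t α β s = trans (cons-∙-cons 0F 0F α β t s)
    (cons-≡ (+F-identityˡ α) (+F-identityˡ β) (trans (cong (λ γ → ζ γ ∙ (t ∙ s)) twist≡0F) (∙-identityˡ (t ∙ s))))
    where twist≡0F = trans (cong₂ _+F_ (*F-zeroˡ β) (cong ⌊_⌋ (carry-0F β))) (+F-identityˡ 0F)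

  cons-factorisation : ∀ α β (s : G m) → cons 0F β ε ∙ (cons α 0F ε ∙ cons₀ s) ≡ cons α β s
  cons-factorisation α β s = begin
    cons 0F β ε ∙ (cons α 0F ε ∙ cons₀ s)
      ≡⟨ cong (cons 0F β ε ∙_) (cons-ε-∙-cons α 0F 0F 0F s) ⟩
    cons 0F β ε ∙ cons (α +F 0F) (0F +F 0F) (ζ (α *F 0F +F ⌊ carry 0F 0F ⌋) ∙ s)
      ≡⟨ cong (cons 0F β ε ∙_) (cons-≡ (+F-identityʳ α) (+F-identityˡ 0F) (ζ0F-∙ (*F-zeroʳ α) (carry-0F 0F))) ⟩
    cons 0F β ε ∙ cons α 0F s
      ≡⟨ cons-ε-∙-cons 0F β α 0F s ⟩
    cons (0F +F α) (β +F 0F) (ζ (0F *F 0F +F ⌊ carry β 0F ⌋) ∙ s)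
      ≡⟨ cons-≡ (+F-identityˡ α) (+F-identityʳ β) (ζ0F-∙ (*F-zeroˡ 0F) (trans (carry-comm β 0F) (carry-0F β))) ⟩
    cons α β s
      ∎
    where
      open ≡-Reasoning
      ζ0F-∙ : ∀ {α k} → α ≡ 0F → k ≡ 0 → ζ (α +F ⌊ k ⌋) ∙ s ≡ s
      ζ0F-∙ refl refl = trans (cong (λ γ → ζ γ ∙ s) (+F-identityˡ 0F)) (∙-identityˡ s)

module WordCalculus (p m : ℕ) where

  open Presentation p m renaming (_∼_ to infix 4 _∼_)

  private variable
    u u′ v v′ w : Word m
    g h : Gen m

  infix 9 _⁺
  _⁺ : Gen m → Gen m × Bool
  g ⁺ = g , false

  infix 8 _^_
  _^_ : Gen m → ℕ → Word m
  g ^ k = powW (gen g) k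

  ∼-setoid : Setoid 0ℓ 0ℓ
  ∼-setoid = record
    { Carrier = Word m ; _≈_ = _∼_
    ; isEquivalence = record { refl = ∼-refl ; sym = ∼-sym ; trans = ∼-trans } }

  ∼-reflexive : u ≡ v → u ∼ v
  ∼-reflexive refl = ∼-refl

  ∼-++ˡ : ∀ l → u ∼ v → l ++ u ∼ l ++ v
  ∼-++ˡ {u} {v} l u∼v =
    subst₂ _∼_ (cong (l ++_) (++-identityʳ u)) (cong (l ++_) (++-identityʳ v)) (∼-ctx l [] u∼v)

  ∼-++ʳ : ∀ r → u ∼ v → u ++ r ∼ v ++ r
  ∼-++ʳ r = ∼-ctx [] r

  ∼-++ : u ∼ u′ → v ∼ v′ → u ++ v ∼ u′ ++ v′
  ∼-++ {u′ = u′} {v = v} u∼u′ v∼v′ = ∼-trans (∼-++ʳ v u∼u′) (∼-++ˡ u′ v∼v′)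

  powW-+ : ∀ w j k → powW w (j + k) ≡ powW w j ++ powW w k
  powW-+ w zero    k = refl
  powW-+ w (suc j) k = trans (cong (w ++_) (powW-+ w j k)) (sym (++-assoc w (powW w j) (powW w k)))

  powW-* : ∀ w q k → powW w (q * k) ≡ powW (powW w k) q
  powW-* w zero    k = refl
  powW-* w (suc q) k = trans (powW-+ w k (q * k)) (cong (powW w k ++_) (powW-* w q k))

  powW-[] : ∀ k → powW [] k ≡ []
  powW-[] zero    = refl
  powW-[] (suc k) = powW-[] k

  ∼-powW : ∀ k → u ∼ v → powW u k ∼ powW v k
  ∼-powW zero    u∼v = ∼-refl
  ∼-powW (suc k) u∼v = ∼-++ u∼v (∼-powW k u∼v)

  ^-mod : .{{_ : NonZero p}} → g ^ p ∼ w → ∀ k → g ^ k ∼ g ^ (k % p) ++ powW w (k / p)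
  ^-mod {g = g} {w = w} gᵖ∼w k = begin
    g ^ k                                  ≡⟨ cong (g ^_) (m≡m%n+[m/n]*n k p) ⟩
    g ^ (k % p + k / p * p)                ≡⟨ powW-+ (gen g) (k % p) (k / p * p) ⟩
    g ^ (k % p) ++ g ^ (k / p * p)         ≡⟨ cong (g ^ (k % p) ++_) (powW-* (gen g) (k / p) p) ⟩
    g ^ (k % p) ++ powW (g ^ p) (k / p)    ≈⟨ ∼-++ˡ (g ^ (k % p)) (∼-powW (k / p) gᵖ∼w) ⟩
    g ^ (k % p) ++ powW w (k / p)          ∎
    where open import Relation.Binary.Reasoning.Setoid ∼-setoid

  ^-mod-[] : .{{_ : NonZero p}} → g ^ p ∼ [] → ∀ k → g ^ k ∼ g ^ (k % p)
  ^-mod-[] {g = g} gᵖ∼[] k = ∼-trans (^-mod gᵖ∼[] k)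
    (∼-reflexive (trans (cong (g ^ (k % p) ++_) (powW-[] (k / p))) (++-identityʳ (g ^ (k % p)))))

  commutator⇒swap : comm (gen g) (gen h) ∼ w → ∀ r → g ⁺ ∷ h ⁺ ∷ r ∼ h ⁺ ∷ g ⁺ ∷ (w ++ r)
  commutator⇒swap {g} {h} {w} [g,h]∼w r = begin
    g ⁺ ∷ h ⁺ ∷ r                                                  ≈⟨ ∼-ctx [] (g ⁺ ∷ h ⁺ ∷ r) (∼-free h false) ⟨
    h ⁺ ∷ (h , true) ∷ g ⁺ ∷ h ⁺ ∷ r                               ≈⟨ ∼-ctx (h ⁺ ∷ []) _ (∼-free g false) ⟨
    h ⁺ ∷ g ⁺ ∷ (g , true) ∷ (h , true) ∷ g ⁺ ∷ h ⁺ ∷ r           ≈⟨ ∼-ctx (h ⁺ ∷ g ⁺ ∷ []) r [g,h]∼w ⟩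
    h ⁺ ∷ g ⁺ ∷ (w ++ r)                                           ∎
    where open import Relation.Binary.Reasoning.Setoid ∼-setoid

  Commute : Gen m → Gen m → Set
  Commute g h = ∀ r → g ⁺ ∷ h ⁺ ∷ r ∼ h ⁺ ∷ g ⁺ ∷ r

  commutator⇒commute : comm (gen g) (gen h) ∼ [] → Commute g h
  commutator⇒commute [g,h]∼[] = commutator⇒swap [g,h]∼[]

  commute-sym : Commute g h → Commute h g
  commute-sym gh r = ∼-sym (gh r)

  commute-pow : Commute g h → ∀ k r → g ⁺ ∷ (h ^ k ++ r) ∼ h ^ k ++ g ⁺ ∷ r
  commute-pow gh zero    r = ∼-refl
  commute-pow {h = h} gh (suc k) r = ∼-trans (gh (h ^ k ++ r)) (∼-++ˡ (h ⁺ ∷ []) (commute-pow gh k r))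

  commute-pow-pow : Commute g h → ∀ j k r →
                    g ^ j ++ h ^ k ++ r ∼ h ^ k ++ g ^ j ++ r
  commute-pow-pow gh zero    k r = ∼-refl
  commute-pow-pow {g} {h} gh (suc j) k r =
    ∼-trans (∼-++ˡ (g ⁺ ∷ []) (commute-pow-pow gh j k r)) (commute-pow gh k (g ^ j ++ r))

  ^-snoc : ∀ k r → g ^ k ++ g ⁺ ∷ r ≡ g ⁺ ∷ g ^ k ++ r
  ^-snoc zero    r = refl
  ^-snoc {g} (suc k) r = cong (g ⁺ ∷_) (^-snoc k r)

  twisted-commute-pow : ∀ {z} → (∀ r → g ⁺ ∷ h ⁺ ∷ r ∼ h ⁺ ∷ g ⁺ ∷ z ⁺ ∷ r) →
                        Commute z h → Commute g z →
                        ∀ k r → g ⁺ ∷ (h ^ k ++ r) ∼ h ^ k ++ z ^ k ++ g ⁺ ∷ r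
  twisted-commute-pow gh≈hgz zh gz zero    r = ∼-refl
  twisted-commute-pow {g} {h} {z} gh≈hgz zh gz (suc k) r = begin
    g ⁺ ∷ h ⁺ ∷ Hᵏ ++ r                      ≈⟨ gh≈hgz (Hᵏ ++ r) ⟩
    h ⁺ ∷ g ⁺ ∷ z ⁺ ∷ Hᵏ ++ r                ≈⟨ ∼-++ˡ (h ⁺ ∷ g ⁺ ∷ []) (commute-pow zh k r) ⟩
    h ⁺ ∷ g ⁺ ∷ Hᵏ ++ z ⁺ ∷ r                ≈⟨ ∼-++ˡ (h ⁺ ∷ []) (twisted-commute-pow gh≈hgz zh gz k (z ⁺ ∷ r)) ⟩
    h ⁺ ∷ Hᵏ ++ Zᵏ ++ g ⁺ ∷ z ⁺ ∷ r          ≈⟨ ∼-++ˡ (h ⁺ ∷ Hᵏ) (∼-++ˡ Zᵏ (gz r)) ⟩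
    h ⁺ ∷ Hᵏ ++ Zᵏ ++ z ⁺ ∷ g ⁺ ∷ r          ≡⟨ cong (λ X → h ⁺ ∷ Hᵏ ++ X) (^-snoc k (g ⁺ ∷ r)) ⟩
    h ⁺ ∷ Hᵏ ++ z ⁺ ∷ Zᵏ ++ g ⁺ ∷ r          ∎
    where open import Relation.Binary.Reasoning.Setoid ∼-setoid
          Hᵏ = h ^ k; Zᵏ = z ^ k

module Lifting (p : ℕ) {m : ℕ} where

  private
    module P = Presentation p m
    module Q = Presentation p (suc m)

  liftGen : Gen m → Gen (suc m)
  liftGen (a i) = a (fs i)
  liftGen (b i) = b (fs i)
  liftGen c     = c

  lift : Word m → Word (suc m)
  lift = map (map₁ liftGen)

  lift-powW : ∀ (w : Word m) k → lift (P.powW w k) ≡ Q.powW (lift w) k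
  lift-powW w zero    = refl
  lift-powW w (suc k) = trans (map-++ _ w (P.powW w k)) (cong (lift w ++_) (lift-powW w k))

  lift-relation : ∀ {u v} → P.Relation u v → Q._∼_ (lift u) (lift v)
  lift-relation (P.[ai,aj] i j)    = Q.∼-rel (Q.[ai,aj] (fs i) (fs j))
  lift-relation (P.[bi,bj] i j)    = Q.∼-rel (Q.[bi,bj] (fs i) (fs j))
  lift-relation (P.[ai,bj] i j i≢j) = Q.∼-rel (Q.[ai,bj] (fs i) (fs j) (i≢j ∘ suc-injective))
  lift-relation (P.[ai,c] i)       = Q.∼-rel (Q.[ai,c] (fs i))
  lift-relation (P.[bi,c] i)       = Q.∼-rel (Q.[bi,c] (fs i))
  lift-relation (P.[ai,bi] i)      = Q.∼-rel (Q.[ai,bi] (fs i))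
  lift-relation (P.ai^p i) = subst (λ w → Q._∼_ w []) (sym (lift-powW (P.gen (a i)) p)) (Q.∼-rel (Q.ai^p (fs i)))
  lift-relation P.c^p      = subst (λ w → Q._∼_ w []) (sym (lift-powW (P.gen c) p)) (Q.∼-rel Q.c^p)
  lift-relation (P.bi^p i) =
    subst (λ w → Q._∼_ w (Q.gen c)) (sym (lift-powW (P.gen (b i)) p)) (Q.∼-rel (Q.bi^p (fs i)))

  lift-∼ : ∀ {u v} → P._∼_ u v → Q._∼_ (lift u) (lift v)
  lift-∼ P.∼-refl          = Q.∼-refl
  lift-∼ (P.∼-sym u∼v)     = Q.∼-sym (lift-∼ u∼v)
  lift-∼ (P.∼-trans u∼v v∼w) = Q.∼-trans (lift-∼ u∼v) (lift-∼ v∼w)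
  lift-∼ (P.∼-ctx l {u} {v} r u∼v) =
    subst₂ Q._∼_ (sym (lift-++₃ u)) (sym (lift-++₃ v)) (Q.∼-ctx (lift l) (lift r) (lift-∼ u∼v))
    where
      lift-++₃ : ∀ w → lift (l ++ w ++ r) ≡ lift l ++ lift w ++ lift r
      lift-++₃ w = trans (map-++ _ l (w ++ r)) (cong (lift l ++_) (map-++ _ w r))
  lift-∼ (P.∼-free g s)    = Q.∼-free (liftGen g) s
  lift-∼ (P.∼-rel rel)     = lift-relation rel

module Isomorphism (p : ℕ) (pr : Prime p) where

  private instance
    p≢0 : NonZero p
    p≢0 = prime⇒nonZero pr

  open Heisenberg p pr
  open Lifting p
  open HeisenbergLike using ([_,_,_])
  open module Pres {m : ℕ} = Presentation p m
    using (comm; gen; invW; Relation; [ai,aj]; [bi,bj]; [ai,bj]; [ai,c]; [bi,c]; [ai,bi]; ai^p; c^p; bi^p;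
           ∼-refl; ∼-sym; ∼-trans; ∼-ctx; ∼-free; ∼-rel)
    renaming (_∼_ to infix 4 _∼_)
  open module WC {m : ℕ} = WordCalculus p m

  private variable m : ℕ

  G-group : ℕ → Group 0ℓ 0ℓ
  G-group m = record { isGroup = ∙-isGroup {m} }

  toℕ-1F : toℕ 1F ≡ 1
  toℕ-1F = trans (toℕ-⌊⌋ 1) (m<n⇒m%n≡m (nonTrivial⇒n>1 p {{prime⇒nonTrivial pr}}))

  toℕ-1F+F : ∀ α → toℕ (1F +F α) ≡ suc (toℕ α) % p
  toℕ-1F+F α = trans (toℕ-⌊⌋ _) (cong (λ k → (k + toℕ α) % p) toℕ-1F)

  ⟦_⟧ : Gen m → G m
  ⟦ a i ⟧ = [ single i 1F , 0v , 0F ]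
  ⟦ b i ⟧ = [ 0v , single i 1F , 0F ]
  ⟦ c ⟧   = ζ 1F

  letter : Gen m × Bool → G m
  letter (g , false) = ⟦ g ⟧
  letter (g , true)  = ⟦ g ⟧ ⁻¹

  eval : Word m → G m
  eval []      = ε
  eval (ℓ ∷ w) = letter ℓ ∙ eval w

  eval-++ : ∀ (u v : Word m) → eval (u ++ v) ≡ eval u ∙ eval v
  eval-++ []      v = sym (∙-identityˡ (eval v))
  eval-++ (ℓ ∷ u) v = trans (cong (letter ℓ ∙_) (eval-++ u v)) (sym (∙-assoc (letter ℓ) (eval u) (eval v)))

  letter-flip : ∀ (g : Gen m) s → letter (g , not s) ≡ letter (g , s) ⁻¹
  letter-flip g false = refl
  letter-flip g true  = sym (⁻¹-involutive ⟦ g ⟧)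
    where open import Algebra.Properties.Group (G-group _) using (⁻¹-involutive)

  eval-invW : ∀ (w : Word m) → eval (invW w) ≡ eval w ⁻¹
  eval-invW {m} []            = sym ε⁻¹≈ε
    where open import Algebra.Properties.Group (G-group m) using (ε⁻¹≈ε)
  eval-invW {m} ((g , s) ∷ w) = begin
    eval (invW ((g , s) ∷ w))                   ≡⟨ cong eval (unfold-reverse (g , not s) (map _ w)) ⟩
    eval (invW w ++ (g , not s) ∷ [])           ≡⟨ eval-++ (invW w) _ ⟩
    eval (invW w) ∙ (letter (g , not s) ∙ ε)    ≡⟨ cong₂ _∙_ (eval-invW w) (trans (∙-identityʳ _) (letter-flip g s)) ⟩
    eval w ⁻¹ ∙ letter (g , s) ⁻¹               ≡⟨ ⁻¹-anti-homo-∙ (letter (g , s)) (eval w) ⟨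
    (letter (g , s) ∙ eval w) ⁻¹                ∎
    where open ≡-Reasoning
          open import Algebra.Properties.Group (G-group m) using (⁻¹-anti-homo-∙)

  eval-a^ : ∀ (i : Fin m) k → eval (a i ^ k) ≡ [ single i ⌊ k ⌋ , 0v , 0F ]
  eval-a^ i zero    = triple-≡ (sym (single-0F i)) refl refl
  eval-a^ i (suc k) = begin
    ⟦ a i ⟧ ∙ eval (a i ^ k)                          ≡⟨ cong (⟦ a i ⟧ ∙_) (eval-a^ i k) ⟩
    [ single i 1F , 0v , 0F ] ∙ [ single i ⌊ k ⌋ , 0v , 0F ] ≡⟨ x-part-∙ (single i 1F) (single i ⌊ k ⌋) ⟩
    [ single i 1F +V single i ⌊ k ⌋ , 0v , 0F ]       ≡⟨ triple-≡ (trans (single-+F i 1F ⌊ k ⌋) (cong (single i) (sym (⌊⌋-+ 1 k))))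
                                                                   refl refl ⟩
    [ single i ⌊ suc k ⌋ , 0v , 0F ]                  ∎
    where open ≡-Reasoning

  k/p+carry≡[1+k]/p : ∀ k → k / p + carry 1F ⌊ k ⌋ ≡ suc k / p
  k/p+carry≡[1+k]/p k = begin
    k / p + carry 1F ⌊ k ⌋            ≡⟨ cong (λ n → k / p + n / p) (trans (cong₂ _+_ toℕ-1F (toℕ-⌊⌋ k)) (+-comm 1 _)) ⟩
    k / p + (k % p + 1) / p           ≡⟨ [m+k]/n≡m/n+[m%n+k]/n k 1 p ⟨
    (k + 1) / p                       ≡⟨ /-congˡ (+-comm k 1) ⟩
    suc k / p                         ∎
    where open ≡-Reasoning

  eval-b^ : ∀ (i : Fin m) k → eval (b i ^ k) ≡ [ 0v , single i ⌊ k ⌋ , ⌊ k / p ⌋ ]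
  eval-b^ i zero    = triple-≡ refl (sym (single-0F i)) (cong ⌊_⌋ (sym (0/n≡0 p)))
  eval-b^ i (suc k) = begin
    ⟦ b i ⟧ ∙ eval (b i ^ k)
      ≡⟨ cong (⟦ b i ⟧ ∙_) (eval-b^ i k) ⟩
    [ 0v , single i 1F , 0F ] ∙ [ 0v , single i ⌊ k ⌋ , ⌊ k / p ⌋ ]
      ≡⟨ y-part-∙ (single i 1F) (single i ⌊ k ⌋) 0F ⌊ k / p ⌋ ⟩
    [ 0v , single i 1F +V single i ⌊ k ⌋ , 0F +F ⌊ k / p ⌋ +F ⌊ carries (single i 1F) (single i ⌊ k ⌋) ⌋ ]
      ≡⟨ triple-≡ refl (single-+F i 1F ⌊ k ⌋)
                  (cong₂ _+F_ (+F-identityˡ ⌊ k / p ⌋) (cong ⌊_⌋ (carries-single i 1F ⌊ k ⌋))) ⟩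
    [ 0v , single i (1F +F ⌊ k ⌋) , ⌊ k / p ⌋ +F ⌊ carry 1F ⌊ k ⌋ ⌋ ]
      ≡⟨ triple-≡ refl (cong (single i) (⌊⌋-+ 1 k)) (trans (cong ⌊_⌋ (sym (k/p+carry≡[1+k]/p k))) (⌊⌋-+ (k / p) _)) ⟨
    [ 0v , single i ⌊ suc k ⌋ , ⌊ suc k / p ⌋ ]
      ∎
    where open ≡-Reasoning

  eval-c^ : ∀ k → eval {m} (c ^ k) ≡ ζ ⌊ k ⌋
  eval-c^ zero    = refl
  eval-c^ (suc k) = trans (cong (ζ 1F ∙_) (eval-c^ k)) (trans (ζ-∙ 1F 0v 0v ⌊ k ⌋) (cong ζ (sym (⌊⌋-+ 1 k))))

  eval-comm : ∀ (g h : Gen m) {k} → ⟦ h ⟧ ∙ ⟦ g ⟧ ∙ k ≡ ⟦ g ⟧ ∙ ⟦ h ⟧ → eval (comm (gen g) (gen h)) ≡ k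
  eval-comm {m} g h {k} hgk≡gh = trans (cong (λ t → ⟦ g ⟧ ⁻¹ ∙ (⟦ h ⟧ ⁻¹ ∙ (⟦ g ⟧ ∙ t))) (∙-identityʳ ⟦ h ⟧))
                                           (commutator≈ (G-group m) ⟦ g ⟧ ⟦ h ⟧ k hgk≡gh)

  eval-comm-ε : ∀ (g h : Gen m) → ⟦ g ⟧ ∙ ⟦ h ⟧ ≡ ⟦ h ⟧ ∙ ⟦ g ⟧ → eval (comm (gen g) (gen h)) ≡ ε
  eval-comm-ε g h gh≡hg = eval-comm g h (trans (∙-identityʳ _) (sym gh≡hg))

  ⟦bᵢ⟧⟦aᵢ⟧⟦c⟧≡⟦aᵢ⟧⟦bᵢ⟧ : ∀ (i : Fin m) → ⟦ b i ⟧ ∙ ⟦ a i ⟧ ∙ (⟦ c ⟧ ∙ ε) ≡ ⟦ a i ⟧ ∙ ⟦ b i ⟧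
  ⟦bᵢ⟧⟦aᵢ⟧⟦c⟧≡⟦aᵢ⟧⟦bᵢ⟧ {m} i = begin
    ⟦ b i ⟧ ∙ ⟦ a i ⟧ ∙ (⟦ c ⟧ ∙ ε)   ≡⟨ cong₂ _∙_ bᵢaᵢ (∙-identityʳ (ζ 1F)) ⟩
    [ e , e , 0F ] ∙ ζ 1F           ≡⟨ ∙-ζ e e 0F 1F ⟩
    [ e , e , 0F +F 1F ]            ≡⟨ triple-≡ refl refl (+F-identityˡ 1F) ⟩
    [ e , e , 1F ]                  ≡⟨ aᵢbᵢ ⟨
    ⟦ a i ⟧ ∙ ⟦ b i ⟧               ∎
    where
      open ≡-Reasoning
      e = single i 1F
      bᵢaᵢ : ⟦ b i ⟧ ∙ ⟦ a i ⟧ ≡ [ e , e , 0F ]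
      bᵢaᵢ = triple-≡ (+V-identityˡ e) (+V-identityʳ e)
        (trans (cong₂ (λ σ k → 0F +F 0F +F σ +F ⌊ k ⌋) (⟨0v,-⟩≡0F {m} 0v) (trans (carries-comm e 0v) (carries-0v e)))
               (trans (+F-identityʳ _) (trans (+F-identityʳ _) (+F-identityʳ 0F))))
      aᵢbᵢ : ⟦ a i ⟧ ∙ ⟦ b i ⟧ ≡ [ e , e , 1F ]
      aᵢbᵢ = triple-≡ (+V-identityʳ e) (+V-identityˡ e)
        (trans (cong₂ (λ σ k → 0F +F 0F +F σ +F ⌊ k ⌋)
                      (trans (⟨single,single⟩ i 1F 1F) (*F-identityˡ 1F)) (carries-0v e))
               (trans (+F-identityʳ _) (trans (cong (_+F 1F) (+F-identityˡ 0F)) (+F-identityˡ 1F))))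

  eval-relation : ∀ {u v : Word m} → Relation u v → eval u ≡ eval v
  eval-relation {m} ([ai,aj] i j)     = eval-comm-ε (a i) (a j) (triple-comm (single i 1F) 0v (single j 1F) 0v 0F 0F
                                          (trans (⟨-,0v⟩≡0F (single i 1F)) (sym (⟨-,0v⟩≡0F (single j 1F)))))
  eval-relation {m} ([bi,bj] i j)     = eval-comm-ε (b i) (b j) (triple-comm 0v (single i 1F) 0v (single j 1F) 0F 0F
                                          (trans (⟨0v,-⟩≡0F (single j 1F)) (sym (⟨0v,-⟩≡0F (single i 1F)))))
  eval-relation {m} ([ai,bj] i j i≢j) = eval-comm-ε (a i) (b j) (triple-comm (single i 1F) 0v 0v (single j 1F) 0F 0F
                                          (trans (⟨single,single⟩-≢ i j i≢j 1F 1F) (sym (⟨0v,-⟩≡0F {m} 0v))))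
  eval-relation {m} ([ai,c] i)        = eval-comm-ε (a i) c (triple-comm (single i 1F) 0v 0v 0v 0F 1F
                                          (trans (⟨-,0v⟩≡0F (single i 1F)) (sym (⟨0v,-⟩≡0F {m} 0v))))
  eval-relation {m} ([bi,c] i)        = eval-comm-ε (b i) c (triple-comm 0v (single i 1F) 0v 0v 0F 1F
                                          (trans (⟨0v,-⟩≡0F {m} 0v) (sym (⟨0v,-⟩≡0F (single i 1F)))))
  eval-relation ([ai,bi] i)           = eval-comm (a i) (b i) (⟦bᵢ⟧⟦aᵢ⟧⟦c⟧≡⟦aᵢ⟧⟦bᵢ⟧ i)
  eval-relation (ai^p i)              = trans (eval-a^ i p) (triple-≡ (single-⌊p⌋ i) refl refl)
  eval-relation c^p                   = trans (eval-c^ p) (cong ζ ⌊p⌋≡0F)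
  eval-relation (bi^p i)              = trans (eval-b^ i p)
    (trans (triple-≡ refl (single-⌊p⌋ i) (cong ⌊_⌋ (n/n≡1 p))) (sym (∙-identityʳ (ζ 1F))))

  eval-cong : ∀ {u v : Word m} → u ∼ v → eval u ≡ eval v
  eval-cong ∼-refl              = refl
  eval-cong (∼-sym v∼u)         = sym (eval-cong v∼u)
  eval-cong (∼-trans u∼w w∼v)   = trans (eval-cong u∼w) (eval-cong w∼v)
  eval-cong (∼-ctx l {u} {v} r u∼v) = begin
    eval (l ++ u ++ r)            ≡⟨ eval-++ l (u ++ r) ⟩
    eval l ∙ eval (u ++ r)        ≡⟨ cong (eval l ∙_) (eval-++ u r) ⟩
    eval l ∙ (eval u ∙ eval r)    ≡⟨ cong (λ t → eval l ∙ (t ∙ eval r)) (eval-cong u∼v) ⟩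
    eval l ∙ (eval v ∙ eval r)    ≡⟨ cong (eval l ∙_) (eval-++ v r) ⟨
    eval l ∙ eval (v ++ r)        ≡⟨ eval-++ l (v ++ r) ⟨
    eval (l ++ v ++ r)            ∎
    where open ≡-Reasoning
  eval-cong (∼-free g s)        = trans (cong (letter (g , s) ∙_) (trans (∙-identityʳ _) (letter-flip g s)))
                                        (∙-inverseʳ (letter (g , s)))
  eval-cong (∼-rel rel)         = eval-relation rel

  ⟦liftGen⟧ : ∀ (g : Gen m) → ⟦ liftGen g ⟧ ≡ cons₀ ⟦ g ⟧
  ⟦liftGen⟧ (a i) = refl
  ⟦liftGen⟧ (b i) = refl
  ⟦liftGen⟧ c     = refl

  cons₀-⁻¹ : ∀ (t : G m) → cons₀ t ⁻¹ ≡ cons₀ (t ⁻¹)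
  cons₀-⁻¹ {m} t = sym (inverseʳ-unique (cons₀ t) (cons₀ (t ⁻¹))
    (trans (cons₀-∙-cons t 0F 0F (t ⁻¹)) (cong cons₀ (∙-inverseʳ t))))
    where open import Algebra.Properties.Group (G-group (suc m)) using (inverseʳ-unique)

  letter-lift : ∀ (ℓ : Gen m × Bool) → letter (map₁ liftGen ℓ) ≡ cons₀ (letter ℓ)
  letter-lift (g , false) = ⟦liftGen⟧ g
  letter-lift (g , true)  = trans (cong _⁻¹ (⟦liftGen⟧ g)) (cons₀-⁻¹ ⟦ g ⟧)

  eval-lift : ∀ (w : Word m) → eval (lift w) ≡ cons₀ (eval w)
  eval-lift []      = refl
  eval-lift (ℓ ∷ w) = trans (cong₂ _∙_ (letter-lift ℓ) (eval-lift w)) (cons₀-∙-cons (letter ℓ) 0F 0F (eval w))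

  nf : G m → Word m
  nf {zero}  [ [] , [] , z ]         = c ^ toℕ z
  nf {suc m} [ α ∷ x , β ∷ y , z ] = b fz ^ toℕ β ++ a fz ^ toℕ α ++ lift (nf [ x , y , z ])

  nf-ε : nf {m} ε ≡ []
  nf-ε {zero}  = cong (c ^_) toℕ-0F
  nf-ε {suc m} = cong₂ (λ k w → b fz ^ k ++ a fz ^ k ++ lift w) toℕ-0F (nf-ε {m})

  eval-nf : ∀ (t : G m) → eval (nf t) ≡ t
  eval-nf {zero}  [ [] , [] , z ]         = trans (eval-c^ (toℕ z)) (cong ζ (⌊toℕ⌋ z))
  eval-nf {suc m} [ α ∷ x , β ∷ y , z ] = begin
    eval (Bᵝ ++ Aᵅ ++ lift (nf s))                 ≡⟨ eval-++ Bᵝ (Aᵅ ++ lift (nf s)) ⟩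
    eval Bᵝ ∙ eval (Aᵅ ++ lift (nf s))             ≡⟨ cong (eval Bᵝ ∙_) (eval-++ Aᵅ (lift (nf s))) ⟩
    eval Bᵝ ∙ (eval Aᵅ ∙ eval (lift (nf s)))       ≡⟨ cong₂ _∙_ eval-Bᵝ (cong₂ _∙_ eval-Aᵅ eval-lift-nf) ⟩
    cons 0F β ε ∙ (cons α 0F ε ∙ cons₀ s)          ≡⟨ cons-factorisation α β s ⟩
    cons α β s                                     ∎
    where
      open ≡-Reasoning
      s = [ x , y , z ]
      Bᵝ = b fz ^ toℕ β
      Aᵅ = a fz ^ toℕ α
      eval-Bᵝ : eval Bᵝ ≡ cons 0F β ε
      eval-Bᵝ = trans (eval-b^ fz (toℕ β)) (cons-≡ refl (⌊toℕ⌋ β) (cong (ζ ∘ ⌊_⌋) (m<n⇒m/n≡0 (toℕ<n β))))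
      eval-Aᵅ : eval Aᵅ ≡ cons α 0F ε
      eval-Aᵅ = trans (eval-a^ fz (toℕ α)) (cons-≡ (⌊toℕ⌋ α) refl refl)
      eval-lift-nf : eval (lift (nf s)) ≡ cons₀ s
      eval-lift-nf = trans (eval-lift (nf s)) (cong cons₀ (eval-nf s))

  Absorbs : Gen m → Set
  Absorbs g = ∀ t → g ⁺ ∷ nf t ∼ nf (⟦ g ⟧ ∙ t)

  absorbs-c^ : Absorbs {m} c → ∀ j t → c ^ j ++ nf t ∼ nf (ζ ⌊ j ⌋ ∙ t)
  absorbs-c^ absorbs-c zero    t = ∼-reflexive (cong nf (sym (∙-identityˡ t)))
  absorbs-c^ {m} absorbs-c (suc j) t = begin
    c ⁺ ∷ c ^ j ++ nf t         ≈⟨ ∼-++ˡ (c ⁺ ∷ []) (absorbs-c^ absorbs-c j t) ⟩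
    c ⁺ ∷ nf (ζ ⌊ j ⌋ ∙ t)      ≈⟨ absorbs-c (ζ ⌊ j ⌋ ∙ t) ⟩
    nf (ζ 1F ∙ (ζ ⌊ j ⌋ ∙ t))   ≡⟨ cong nf (trans (ζ-∙-ζ 1F ⌊ j ⌋ t) (cong (λ γ → ζ γ ∙ t) (sym (⌊⌋-+ 1 j)))) ⟩
    nf (ζ ⌊ suc j ⌋ ∙ t)        ∎
    where open import Relation.Binary.Reasoning.Setoid (∼-setoid {m})

  absorbs-c^-lift : Absorbs {m} c → ∀ j s → c ^ j ++ lift (nf s) ∼ lift (nf (ζ ⌊ j ⌋ ∙ s))
  absorbs-c^-lift absorbs-c j s = ∼-trans (∼-reflexive (sym lift-c^)) (lift-∼ (absorbs-c^ absorbs-c j s))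
    where lift-c^ = trans (map-++ _ (c ^ j) (nf s)) (cong (_++ lift (nf s)) (lift-powW (gen c) j))

  commute-a₀-c : Commute {suc m} (a fz) c
  commute-a₀-c = commutator⇒commute (∼-rel ([ai,c] fz))

  commute-c-b₀ : Commute {suc m} c (b fz)
  commute-c-b₀ = commute-sym (commutator⇒commute (∼-rel ([bi,c] fz)))

  a₀b₀-swap : ∀ (r : Word (suc m)) → a fz ⁺ ∷ b fz ⁺ ∷ r ∼ b fz ⁺ ∷ a fz ⁺ ∷ c ⁺ ∷ r
  a₀b₀-swap = commutator⇒swap (∼-rel ([ai,bi] fz))

  commute-lift-a₀ : ∀ (g : Gen m) → Commute (liftGen g) (a fz)
  commute-lift-a₀ (a i) = commutator⇒commute (∼-rel ([ai,aj] (fs i) fz))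
  commute-lift-a₀ (b i) = commute-sym (commutator⇒commute (∼-rel ([ai,bj] fz (fs i) λ ())))
  commute-lift-a₀ c     = commute-sym commute-a₀-c

  commute-lift-b₀ : ∀ (g : Gen m) → Commute (liftGen g) (b fz)
  commute-lift-b₀ (a i) = commutator⇒commute (∼-rel ([ai,bj] (fs i) fz λ ()))
  commute-lift-b₀ (b i) = commutator⇒commute (∼-rel ([bi,bj] (fs i) fz))
  commute-lift-b₀ c     = commute-c-b₀

  a₀-∙-cons : ∀ α β (s : G m) → ⟦ a fz ⟧ ∙ cons α β s ≡ cons (1F +F α) β (ζ β ∙ s)
  a₀-∙-cons α β s = trans (cons-ε-∙-cons 1F 0F α β s) (cons-≡ refl (+F-identityˡ β) (cong (λ γ → ζ γ ∙ s) shift≡β))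
    where shift≡β = trans (cong₂ _+F_ (*F-identityˡ β) (cong ⌊_⌋ (carry-0F β))) (+F-identityʳ β)

  b₀-∙-cons : ∀ α β (s : G m) → ⟦ b fz ⟧ ∙ cons α β s ≡ cons α (1F +F β) (ζ ⌊ suc (toℕ β) / p ⌋ ∙ s)
  b₀-∙-cons α β s = trans (cons-ε-∙-cons 0F 1F α β s) (cons-≡ (+F-identityˡ α) refl (cong (λ γ → ζ γ ∙ s) shift≡carry))
    where shift≡carry = trans (cong (_+F ⌊ carry 1F β ⌋) (*F-zeroˡ β))
                              (trans (+F-identityˡ _) (cong (λ n → ⌊ (n + toℕ β) / p ⌋) toℕ-1F))

  absorbs-lift : ∀ (g : Gen m) → Absorbs g → Absorbs (liftGen g)
  absorbs-lift {m} g absorbs-g [ α ∷ x , β ∷ y , z ] = begin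
    liftGen g ⁺ ∷ Bᵝ ++ Aᵅ ++ lift (nf s)   ≈⟨ commute-pow (commute-lift-b₀ g) (toℕ β) (Aᵅ ++ lift (nf s)) ⟩
    Bᵝ ++ liftGen g ⁺ ∷ Aᵅ ++ lift (nf s)   ≈⟨ ∼-++ˡ Bᵝ (commute-pow (commute-lift-a₀ g) (toℕ α) (lift (nf s))) ⟩
    Bᵝ ++ Aᵅ ++ lift (g ⁺ ∷ nf s)           ≈⟨ ∼-++ˡ Bᵝ (∼-++ˡ Aᵅ (lift-∼ (absorbs-g s))) ⟩
    nf (cons α β (⟦ g ⟧ ∙ s))               ≡⟨ cong nf (trans (cong (_∙ cons α β s) (⟦liftGen⟧ g))
                                                                (cons₀-∙-cons ⟦ g ⟧ α β s)) ⟨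
    nf (⟦ liftGen g ⟧ ∙ cons α β s)         ∎
    where open import Relation.Binary.Reasoning.Setoid (∼-setoid {suc m})
          s = [ x , y , z ]; Bᵝ = b fz ^ toℕ β; Aᵅ = a fz ^ toℕ α

  absorbs-a₀ : Absorbs {m} c → Absorbs {suc m} (a fz)
  absorbs-a₀ {m} absorbs-c [ α ∷ x , β ∷ y , z ] = begin
    a fz ⁺ ∷ Bᵝ ++ Aᵅ ++ R
      ≈⟨ twisted-commute-pow a₀b₀-swap commute-c-b₀ commute-a₀-c (toℕ β) (Aᵅ ++ R) ⟩
    Bᵝ ++ Cᵝ ++ a fz ^ suc (toℕ α) ++ R
      ≈⟨ ∼-++ˡ Bᵝ (∼-++ˡ Cᵝ (∼-++ʳ R (^-mod-[] (∼-rel (ai^p fz)) (suc (toℕ α))))) ⟩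
    Bᵝ ++ Cᵝ ++ A′ ++ R
      ≈⟨ ∼-++ˡ Bᵝ (commute-pow-pow (commute-sym commute-a₀-c) (toℕ β) (suc (toℕ α) % p) R) ⟩
    Bᵝ ++ A′ ++ Cᵝ ++ R
      ≈⟨ ∼-++ˡ Bᵝ (∼-++ˡ A′ (absorbs-c^-lift absorbs-c (toℕ β) s)) ⟩
    Bᵝ ++ A′ ++ lift (nf (ζ ⌊ toℕ β ⌋ ∙ s))
      ≡⟨ cong₂ (λ k γ → Bᵝ ++ a fz ^ k ++ lift (nf (ζ γ ∙ s))) (sym (toℕ-1F+F α)) (⌊toℕ⌋ β) ⟩
    nf (cons (1F +F α) β (ζ β ∙ s))
      ≡⟨ cong nf (a₀-∙-cons α β s) ⟨
    nf (⟦ a fz ⟧ ∙ cons α β s)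
      ∎
    where open import Relation.Binary.Reasoning.Setoid (∼-setoid {suc m})
          s = [ x , y , z ]; R = lift (nf s)
          Bᵝ = b fz ^ toℕ β; Cᵝ = c ^ toℕ β; Aᵅ = a fz ^ toℕ α; A′ = a fz ^ (suc (toℕ α) % p)

  absorbs-b₀ : Absorbs {m} c → Absorbs {suc m} (b fz)
  absorbs-b₀ {m} absorbs-c [ α ∷ x , β ∷ y , z ] = begin
    b fz ^ k ++ Aᵅ ++ R
      ≈⟨ ∼-++ʳ (Aᵅ ++ R) (^-mod (∼-rel (bi^p fz)) k) ⟩
    (B′ ++ c ^ (k / p)) ++ Aᵅ ++ R
      ≡⟨ ++-assoc B′ (c ^ (k / p)) (Aᵅ ++ R) ⟩
    B′ ++ c ^ (k / p) ++ Aᵅ ++ R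
      ≈⟨ ∼-++ˡ B′ (commute-pow-pow (commute-sym commute-a₀-c) (k / p) (toℕ α) R) ⟩
    B′ ++ Aᵅ ++ c ^ (k / p) ++ R
      ≈⟨ ∼-++ˡ B′ (∼-++ˡ Aᵅ (absorbs-c^-lift absorbs-c (k / p) s)) ⟩
    B′ ++ Aᵅ ++ lift (nf (ζ ⌊ k / p ⌋ ∙ s))
      ≡⟨ cong (λ n → b fz ^ n ++ Aᵅ ++ lift (nf (ζ ⌊ k / p ⌋ ∙ s))) (toℕ-1F+F β) ⟨
    nf (cons α (1F +F β) (ζ ⌊ k / p ⌋ ∙ s))
      ≡⟨ cong nf (b₀-∙-cons α β s) ⟨
    nf (⟦ b fz ⟧ ∙ cons α β s)
      ∎
    where open import Relation.Binary.Reasoning.Setoid (∼-setoid {suc m})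
          s = [ x , y , z ]; R = lift (nf s); k = suc (toℕ β)
          Aᵅ = a fz ^ toℕ α; B′ = b fz ^ (k % p)

  absorbs-c₀ : Absorbs {zero} c
  absorbs-c₀ [ [] , [] , z ] = begin
    c ^ suc (toℕ z)                 ≈⟨ ^-mod-[] (∼-rel c^p) (suc (toℕ z)) ⟩
    c ^ (suc (toℕ z) % p)           ≡⟨ cong (c ^_) (toℕ-1F+F z) ⟨
    nf [ [] , [] , 1F +F z ]        ≡⟨ cong nf (ζ-∙ 1F [] [] z) ⟨
    nf (ζ 1F ∙ [ [] , [] , z ])     ∎
    where open import Relation.Binary.Reasoning.Setoid (∼-setoid {zero})

  absorbs : ∀ (g : Gen m) → Absorbs g
  absorbs {zero}  (a ())
  absorbs {zero}  (b ())
  absorbs {zero}  c          = absorbs-c₀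
  absorbs {suc m} (a fz)     = absorbs-a₀ (absorbs c)
  absorbs {suc m} (b fz)     = absorbs-b₀ (absorbs c)
  absorbs {suc m} (a (fs i)) = absorbs-lift (a i) (absorbs (a i))
  absorbs {suc m} (b (fs i)) = absorbs-lift (b i) (absorbs (b i))
  absorbs {suc m} c          = absorbs-lift c (absorbs c)

  word∼nf : ∀ (w : Word m) → w ∼ nf (eval w)
  word∼nf []               = ∼-sym (∼-reflexive nf-ε)
  word∼nf ((g , false) ∷ w) = ∼-trans (∼-++ˡ (g ⁺ ∷ []) (word∼nf w)) (absorbs g (eval w))
  word∼nf {m} ((g , true) ∷ w) = begin
    (g , true) ∷ w                           ≈⟨ ∼-++ˡ ((g , true) ∷ []) (word∼nf w) ⟩
    (g , true) ∷ nf (eval w)                 ≡⟨ cong (λ t → (g , true) ∷ nf t) (\\-leftDividesˡ ⟦ g ⟧ (eval w)) ⟨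
    (g , true) ∷ nf (⟦ g ⟧ ∙ t)              ≈⟨ ∼-++ˡ ((g , true) ∷ []) (absorbs g t) ⟨
    (g , true) ∷ g ⁺ ∷ nf t                  ≈⟨ ∼-ctx [] (nf t) (∼-free g true) ⟩
    nf t                                     ∎
    where open import Relation.Binary.Reasoning.Setoid (∼-setoid {m})
          open import Algebra.Properties.Group (G-group m) using (\\-leftDividesˡ)
          t = ⟦ g ⟧ ⁻¹ ∙ eval w

  nf-isGroupIsomorphism : GroupMorphisms.IsGroupIsomorphism (GRaw p pr m ε _⁻¹) (Presentation.M p m) nf
  nf-isGroupIsomorphism = record
    { isGroupMonomorphism = record
      { isGroupHomomorphism = record
        { isMonoidHomomorphism = record
          { isMagmaHomomorphism = record
            { isRelHomomorphism = record { cong = λ { refl → ∼-refl } }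
            ; homo = λ t s → ∼-sym (∼nf (trans (eval-++ (nf t) (nf s)) (cong₂ _∙_ (eval-nf t) (eval-nf s)))) }
          ; ε-homo = ∼-reflexive nf-ε }
        ; ⁻¹-homo = λ t → ∼-sym (∼nf (trans (eval-invW (nf t)) (cong _⁻¹ (eval-nf t)))) }
      ; injective = λ {t} {s} nf-t∼nf-s → trans (sym (eval-nf t)) (trans (eval-cong nf-t∼nf-s) (eval-nf s)) }
    ; surjective = λ w → eval w , λ { refl → ∼-sym (word∼nf w) } }
    where
      ∼nf : ∀ {w t} → eval w ≡ t → w ∼ nf t
      ∼nf {w} refl = word∼nf w

lemma2p1 : (p : ℕ) (pr : Prime p) (n : ℕ) → 1 ≤ n →
    let open HeisenbergLike p pr n in
    Σ[ e ∈ Triple ] Σ[ inv ∈ (Triple → Triple) ]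
      Σ[ isG ∈ IsGroup {A = Triple} _≡_ _·_ e inv ]
        Σ[ φ ∈ (Triple → Word n) ]
          GroupMorphisms.IsGroupIsomorphism
            (GRaw p pr n e inv)
            (Presentation.M p n) φ
lemma2p1 p pr n _ = ε , _⁻¹ , ∙-isGroup , nf , nf-isGroupIsomorphism
  where open Heisenberg p pr
        open Isomorphism p pr
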